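{- Let $p\equiv1\pmod4$ be a prime and let $a,b,c,d\in\mathbb{F}_p^{\times,2}$. Then there exists $y_0\in\mathbb{F}_p^\times$ such that either (i) $a+by_0^2$ and $c+dy_0^2$ both lie in $\mathbb{F}_p^\times\setminus\mathbb{F}_p^{\times,2}$, or (ii) $a+by_0^2\in\mathbb{F}_p^\times\setminus\mathbb{F}_p^{\times,2}$ and $c+dy_0^2=0$.
   Context: $\mathbb{F}_p^{\times,2}$ denotes the set of nonzero squares in $\mathbb{F}_p$. -}

module Defs where

open import Data.Nat using (ℕ; _+_; _*_; _<_; NonZero)
open import Data.Nat.DivMod using (_%_)
open import Data.Product using (Σ; _×_; ∃)
open import Relation.Binary.PropositionalEquality using (_≡_; _≢_)
open import Relation.Nullary using (¬_)

-- The prime field F_p is modelled by the residues {0, …, p-1} ⊂ ℕ,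
-- with addition and multiplication computed modulo p.

NonzeroMod : (p : ℕ) → ℕ → Set
NonzeroMod p x = x < p × x ≢ 0

NonzeroSquareMod : (p : ℕ) .{{_ : NonZero p}} → ℕ → Set
NonzeroSquareMod p x = NonzeroMod p x × Σ ℕ (λ z → z < p × (z * z) % p ≡ x)

NonsquareMod : (p : ℕ) .{{_ : NonZero p}} → ℕ → Set
NonsquareMod p x = NonzeroMod p x × ¬ NonzeroSquareMod p x

quadMod : (p : ℕ) .{{_ : NonZero p}} → ℕ → ℕ → ℕ → ℕ
quadMod p a b y = (a + b * (y * y)) % p

-- Multiplying by a nonzero square preserves quadratic character, so with e = ad/(bc) it suffices to
-- find a nonzero square u such that 1 + u is a nonsquare and 1 + ue is a nonsquare or zero: then
-- y² = au/b gives a + by² = a(1 + u) and c + dy² = c(1 + ue).  Sort the nonzero residues x by whether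
-- x and 1 + x are squares (S) or nonsquares (N).  Since p ≡ 1 (mod 4), -1 is a square, so x ↦ -1 - x
-- embeds NS into SN and x ↦ 1/x embeds NN into NS.  Hence (p-1)/2 = |NS| + |NN| ≤ 2|SN|, whereas
-- (p-1)/2 = |SN| + |SS| + 1, the 1 accounting for x = -1.  So |SS| < |SN| and the injection u ↦ ue
-- cannot map SN into SS.

module Submission where

open import Defs
open import Data.Nat using (ℕ; _%_; NonZero)
open import Data.Nat.Primality using (Prime)
open import Data.Product using (Σ; _×_)
open import Data.Sum using (_⊎_)
open import Relation.Binary.PropositionalEquality using (_≡_)

module Counting where

  open import Data.Nat using (ℕ; zero; suc; _+_; _<_; _≤_; z≤n; s≤s; _≟_; _<?_; _≤?_)
  open import Data.Nat.Properties
    using (≤-refl; ≤-pred; n<1+n; m<n⇒m<1+n; m≤n⇒m<n∨m≡n; m≤n⇒m≤1+n; +-suc; <⇒≢; <⇒≱; module ≤-Reasoning)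
  open import Data.Product using (∃; _×_; _,_; proj₁; proj₂)
  open import Data.Sum using (_⊎_; inj₁; inj₂)
  open import Function using (_on_; _∘_)
  open import Function.Bundles using (_⇔_; mk⇔; Equivalence)
  open import Function.Definitions using (Injective)
  open import Level using (Level)
  open import Relation.Nullary using (yes; no; contradiction)
  open import Relation.Nullary.Decidable using (_×-dec_)
  open import Relation.Unary using (Pred; Decidable; _∩_; ∁)
  open import Relation.Unary.Properties using (_∩?_; ∁?)
  open import Relation.Binary.PropositionalEquality using (_≡_; _≢_; refl; sym; trans; cong; subst)

  private variable
    ℓ ℓ′ : Level
    P Q : Pred ℕ ℓ

  Below : Pred ℕ ℓ → ℕ → Set ℓ
  Below P n = ∃ λ x → x < n × P x

  count : Decidable P → ℕ → ℕ
  count P? zero = 0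
  count P? (suc n) with P? n
  ... | yes _ = suc (count P? n)
  ... | no  _ = count P? n

  private
    <suc⇒<⊎≡ : ∀ {x n} → x < suc n → x < n ⊎ x ≡ n
    <suc⇒<⊎≡ = m≤n⇒m<n∨m≡n ∘ ≤-pred

  count-cong : (P? : Decidable P) (Q? : Decidable Q) →
    ∀ n → (∀ {x} → x < n → P x ⇔ Q x) → count P? n ≡ count Q? n
  count-cong P? Q? zero      P⇔Q = refl
  count-cong P? Q? (suc n) P⇔Q with P? n | Q? n
  ... | yes _  | yes _  = cong suc (count-cong P? Q? n (P⇔Q ∘ m<n⇒m<1+n))
  ... | no  _  | no  _  = count-cong P? Q? n (P⇔Q ∘ m<n⇒m<1+n)
  ... | yes Pn | no ¬Qn = contradiction (Equivalence.to (P⇔Q ≤-refl) Pn) ¬Qn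
  ... | no ¬Pn | yes Qn = contradiction (Equivalence.from (P⇔Q ≤-refl) Qn) ¬Pn

  count-remove : (P? : Decidable P) → ∀ {n y} → y < n → P y →
    count P? n ≡ suc (count (P? ∩? ∁? (_≟ y)) n)
  count-remove P? {suc n} {y} y<1+n Py with <suc⇒<⊎≡ y<1+n
  ... | inj₁ y<n with P? n | (P? ∩? ∁? (_≟ y)) n
  ...   | yes _  | yes _           = cong suc (count-remove P? y<n Py)
  ...   | no  _  | no  _           = count-remove P? y<n Py
  ...   | yes Pn | no ¬[Pn×n≢y]    = contradiction (Pn , <⇒≢ y<n ∘ sym) ¬[Pn×n≢y]
  ...   | no ¬Pn | yes (Pn , _)    = contradiction Pn ¬Pn
  count-remove P? {suc n} _ Py | inj₂ refl with P? n | (P? ∩? ∁? (_≟ n)) n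
  ...   | yes _  | no  _           = cong suc (count-cong P? (P? ∩? ∁? (_≟ n)) n
                                       λ x<n → mk⇔ (λ Px → Px , <⇒≢ x<n) proj₁)
  ...   | _      | yes (_ , n≢n)   = contradiction refl n≢n
  ...   | no ¬Pn | _               = contradiction Py ¬Pn

  private
    widen : ∀ {m} → Below P m → Below P (suc m)
    widen (x , x<m , Px) = x , m<n⇒m<1+n x<m , Px

  count-injection : (P? : Decidable P) (Q? : Decidable Q) → ∀ {m n}
    (f : Below P m → Below Q n) → Injective (_≡_ on proj₁) (_≡_ on proj₁) f →
    count P? m ≤ count Q? n
  count-injection P? Q? {zero} f f-inj = z≤n
  count-injection P? Q? {suc m} f f-inj with P? m
  ... | no _ = count-injection P? Q? (f ∘ widen) f-inj
  count-injection {P = P} {Q = Q} P? Q? {suc m} {n} f f-inj | yes Pm = begin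
      suc (count P? m)                  ≤⟨ s≤s (count-injection P? (Q? ∩? ∁? (_≟ y)) f′ f-inj) ⟩
      suc (count (Q? ∩? ∁? (_≟ y)) n)   ≡⟨ count-remove Q? y<n Qy ⟨
      count Q? n                        ∎
    where
    open ≤-Reasoning
    top : Below Q n
    top = f (m , n<1+n m , Pm)
    y : ℕ
    y = proj₁ top
    y<n : y < n
    y<n = proj₁ (proj₂ top)
    Qy : Q y
    Qy = proj₂ (proj₂ top)
    f′ : Below P m → Below (Q ∩ ∁ (_≡ y)) n
    f′ a@(x , x<m , _) = let (z , z<n , Qz) = f (widen a) in
      z , z<n , Qz , λ z≡y → <⇒≢ x<m (f-inj z≡y)

  count-partition : (P? : Decidable P) (Q? : Decidable Q) → ∀ n →
    count P? n ≡ count (P? ∩? Q?) n + count (P? ∩? ∁? Q?) n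
  count-partition P? Q? zero = refl
  count-partition P? Q? (suc n) with P? n | Q? n
  ... | no  _ | _     = count-partition P? Q? n
  ... | yes _ | yes _ = cong suc (count-partition P? Q? n)
  ... | yes _ | no  _ = trans (cong suc (count-partition P? Q? n)) (sym (+-suc _ _))

  0<count⇒Below : (P? : Decidable P) → ∀ n → 0 < count P? n → Below P n
  0<count⇒Below P? (suc n) 0<c with P? n
  ... | yes Pn = n , n<1+n n , Pn
  ... | no  _  = widen (0<count⇒Below P? n 0<c)

  OneTo : ℕ → Pred ℕ _
  OneTo h x = 0 < x × x ≤ h

  oneTo? : ∀ h → Decidable (OneTo h)
  oneTo? h x = 0 <? x ×-dec x ≤? h

  count-oneTo : ∀ h n → h < n → count (oneTo? h) n ≡ h
  count-oneTo h (suc n) h<1+n with <suc⇒<⊎≡ h<1+n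
  ... | inj₁ h<n with oneTo? h n
  ...   | no  _         = count-oneTo h n h<n
  ...   | yes (_ , n≤h) = contradiction n≤h (<⇒≱ h<n)
  count-oneTo zero (suc n) _ | inj₂ refl = refl
  count-oneTo (suc h) (suc n) _ | inj₂ refl with oneTo? (suc h) (suc h)
  ...   | yes _ = cong suc (trans (count-cong (oneTo? (suc h)) (oneTo? h) (suc h) shrink)
                                 (count-oneTo h (suc h) ≤-refl))
    where
    shrink : ∀ {x} → x < suc h → OneTo (suc h) x ⇔ OneTo h x
    shrink x<1+h = mk⇔ (λ (0<x , _) → 0<x , ≤-pred x<1+h) (λ (0<x , x≤h) → 0<x , m≤n⇒m≤1+n x≤h)
  ...   | no ¬1+h∈[1,1+h] = contradiction (s≤s z≤n , ≤-refl) ¬1+h∈[1,1+h]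

  count-involution : (P? : Decidable P) (σ : ℕ → ℕ) → ∀ n →
    (∀ {x} → x < n → P x → σ x < n × P (σ x) × σ (σ x) ≡ x × σ x ≢ x) →
    ∃ λ k → count P? n ≡ k + k
  count-involution P? σ zero σ-inv = 0 , refl
  count-involution {P = P} P? σ (suc n) σ-inv with P? n
  ... | no ¬Pn = count-involution P? σ n σ-inv′
    where
    σ-inv′ : ∀ {x} → x < n → P x → σ x < n × P (σ x) × σ (σ x) ≡ x × σ x ≢ x
    σ-inv′ x<n Px with σ-inv (m<n⇒m<1+n x<n) Px
    ... | σx<1+n , Pσx , σσx≡x , σx≢x with <suc⇒<⊎≡ σx<1+n
    ...   | inj₁ σx<n  = σx<n , Pσx , σσx≡x , σx≢x
    ...   | inj₂ σx≡n  = contradiction (subst P σx≡n Pσx) ¬Pn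
  ... | yes Pn with σ-inv (n<1+n n) Pn
  ...   | σn<1+n , Pσn , σσn≡n , σn≢n with <suc⇒<⊎≡ σn<1+n
  ...     | inj₂ σn≡n = contradiction σn≡n σn≢n
  ...     | inj₁ σn<n =
    let k , eq = count-involution (P? ∩? ∁? (_≟ σ n)) σ n σ-inv′ in
    suc k , cong suc (trans (count-remove P? σn<n Pσn) (trans (cong suc eq) (sym (+-suc k k))))
    where
    σ-inv′ : ∀ {x} → x < n → (P ∩ ∁ (_≡ σ n)) x →
      σ x < n × (P ∩ ∁ (_≡ σ n)) (σ x) × σ (σ x) ≡ x × σ x ≢ x
    σ-inv′ {x} x<n (Px , x≢σn) with σ-inv (m<n⇒m<1+n x<n) Px
    ... | σx<1+n , Pσx , σσx≡x , σx≢x with <suc⇒<⊎≡ σx<1+n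
    ...   | inj₂ σx≡n = contradiction (trans (sym σσx≡x) (cong σ σx≡n)) x≢σn
    ...   | inj₁ σx<n = σx<n , (Pσx , σx≢σn) , σσx≡x , σx≢x
      where
      σx≢σn : σ x ≢ σ n
      σx≢σn σx≡σn = <⇒≢ x<n (trans (sym σσx≡x) (trans (cong σ σx≡σn) σσn≡n))

open Counting

open import Data.Nat as ℕ using (zero; suc)
import Data.Nat.Properties as ℕ
import Data.Nat.Divisibility as ℕ
import Data.Nat.DivMod as ℕ
import Data.Nat.Tactic.RingSolver as ℕ-Solver
open import Data.Nat.GCD using (module Bézout; module GCD; GCD)
open import Data.Nat.Coprimality as Coprime using (coprime⇒GCD≡1; prime⇒coprime)
open import Data.Nat.Primality using (prime⇒nonZero; prime⇒nonTrivial; euclidsLemma)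
open import Data.Integer using (ℤ; +_; _+_; _*_; -_; _-_; 0ℤ; 1ℤ; ∣_∣; _⊖_; _%ℕ_; _/ℕ_)
open import Data.Integer.Properties
  using (pos-+; pos-*; m-n≡m⊖n; ⊖-≥; ∣⊖∣-≤; ∣m⊖n∣≡∣n⊖m∣; +-inverseˡ; +-inverseʳ; +-identityˡ; +-identityʳ;
         *-zeroˡ; *-zeroʳ; *-identityˡ; *-identityʳ; *-assoc; *-comm; abs-*; neg-involutive)
open import Data.Integer.DivMod using (n%ℕd<d; a≡a%ℕn+[a/ℕn]*n)
open import Data.Integer.Divisibility.Signed
  using (_∣_; divides; ∣⇒∣ᵤ; ∣ᵤ⇒∣; ∣m∣n⇒∣m+n; ∣m⇒∣-m; ∣m⇒∣m*n; ∣n⇒∣m*n)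
open import Data.Integer.Tactic.RingSolver using (solve-∀)
open import Data.Product as Prod using (∃; _,_; proj₁; proj₂)
open import Data.Sum as Sum using (inj₁; inj₂)
open import Function using (_∘_; id)
open import Function.Bundles using (_⇔_; mk⇔)
open import Level using (Level)
open import Relation.Binary.Bundles using (Setoid)
open import Relation.Binary.Definitions using (_Respects_)
open import Relation.Binary.PropositionalEquality
  using (_≢_; refl; sym; trans; cong; subst; module ≡-Reasoning)
import Relation.Binary.Reasoning.Setoid
open import Relation.Binary.Structures using (IsEquivalence)
open import Relation.Nullary using (¬_; Dec; yes; no; contradiction)
import Relation.Nullary.Decidable as Dec
open import Relation.Nullary.Decidable using (_×-dec_; _⊎-dec_; ¬?; decidable-stable)
open import Relation.Unary using (Pred; Decidable; _∩_; ∁)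
open import Relation.Unary.Properties using (_∩?_; ∁?)

private
  ∣m⊖n∣≡∣m-n∣ : ∀ m n → ∣ m ⊖ n ∣ ≡ ℕ.∣ m - n ∣
  ∣m⊖n∣≡∣m-n∣ m n with ℕ.≤-total m n
  ... | inj₁ m≤n = trans (∣⊖∣-≤ m≤n) (sym (ℕ.m≤n⇒∣m-n∣≡n∸m m≤n))
  ... | inj₂ n≤m = trans (∣m⊖n∣≡∣n⊖m∣ m n)
                     (trans (∣⊖∣-≤ n≤m) (sym (trans (ℕ.∣-∣-comm m n) (ℕ.m≤n⇒∣m-n∣≡n∸m n≤m))))

private variable
  ℓ ℓ′ : Level

module Congruence (p : ℕ) .{{_ : NonZero p}} where

  infix 4 _≈_ _≉_ _≈?_

  record _≈_ (x y : ℤ) : Set where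
    constructor mk≈
    field p∣x-y : + p ∣ x - y

  _≉_ : ℤ → ℤ → Set
  x ≉ y = ¬ x ≈ y

  ≈-reflexive : ∀ {x y} → x ≡ y → x ≈ y
  ≈-reflexive {x} refl = mk≈ (divides 0ℤ (trans (+-inverseʳ x) (sym (*-zeroˡ (+ p)))))

  ≈-refl : ∀ {x} → x ≈ x
  ≈-refl = ≈-reflexive refl

  ≈-sym : ∀ {x y} → x ≈ y → y ≈ x
  ≈-sym {x} {y} (mk≈ p∣x-y) = mk≈ (subst (+ p ∣_) (eq x y) (∣m⇒∣-m p∣x-y))
    where
    eq : ∀ x y → - (x - y) ≡ y - x
    eq = solve-∀

  ≈-trans : ∀ {x y z} → x ≈ y → y ≈ z → x ≈ z
  ≈-trans {x} {y} {z} (mk≈ p∣x-y) (mk≈ p∣y-z) =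
    mk≈ (subst (+ p ∣_) (eq x y z) (∣m∣n⇒∣m+n p∣x-y p∣y-z))
    where
    eq : ∀ x y z → (x - y) + (y - z) ≡ x - z
    eq = solve-∀

  ≈-isEquivalence : IsEquivalence _≈_
  ≈-isEquivalence = record { refl = ≈-refl ; sym = ≈-sym ; trans = ≈-trans }

  ≈-setoid : Setoid _ _
  ≈-setoid = record { isEquivalence = ≈-isEquivalence }

  module ≈-Reasoning = Relation.Binary.Reasoning.Setoid ≈-setoid

  +-cong : ∀ {x y u v} → x ≈ y → u ≈ v → x + u ≈ y + v
  +-cong {x} {y} {u} {v} (mk≈ p∣x-y) (mk≈ p∣u-v) =
    mk≈ (subst (+ p ∣_) (eq x y u v) (∣m∣n⇒∣m+n p∣x-y p∣u-v))
    where
    eq : ∀ x y u v → (x - y) + (u - v) ≡ (x + u) - (y + v)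
    eq = solve-∀

  *-cong : ∀ {x y u v} → x ≈ y → u ≈ v → x * u ≈ y * v
  *-cong {x} {y} {u} {v} (mk≈ p∣x-y) (mk≈ p∣u-v) =
    mk≈ (subst (+ p ∣_) (eq x y u v) (∣m∣n⇒∣m+n (∣m⇒∣m*n u p∣x-y) (∣n⇒∣m*n y p∣u-v)))
    where
    eq : ∀ x y u v → (x - y) * u + y * (u - v) ≡ x * u - y * v
    eq = solve-∀

  -‿cong : ∀ {x y} → x ≈ y → - x ≈ - y
  -‿cong {x} {y} (mk≈ p∣x-y) = mk≈ (subst (+ p ∣_) (eq x y) (∣m⇒∣-m p∣x-y))
    where
    eq : ∀ x y → - (x - y) ≡ - x - - y
    eq = solve-∀

  +-congˡ : ∀ {x u v} → u ≈ v → x + u ≈ x + v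
  +-congˡ {x} = +-cong (≈-refl {x})

  *-congˡ : ∀ {x u v} → u ≈ v → x * u ≈ x * v
  *-congˡ {x} = *-cong (≈-refl {x})

  *-congʳ : ∀ {x y u} → x ≈ y → x * u ≈ y * u
  *-congʳ x≈y = *-cong x≈y ≈-refl

  p≈0 : + p ≈ 0ℤ
  p≈0 = mk≈ (divides 1ℤ (trans (+-identityʳ (+ p)) (sym (*-identityˡ (+ p)))))

  0<p : 0 ℕ.< p
  0<p = ℕ.>-nonZero⁻¹ p

  residue : ℤ → ℕ
  residue x = x %ℕ p

  residue-+ : ∀ {n} → n ℕ.< p → residue (+ n) ≡ n
  residue-+ = ℕ.m<n⇒m%n≡m

  residue<p : ∀ x → residue x ℕ.< p
  residue<p x = n%ℕd<d x p

  residue≈ : ∀ x → + residue x ≈ x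
  residue≈ x = mk≈ (divides (- (x /ℕ p))
    (trans (cong (λ t → + residue x - t) (a≡a%ℕn+[a/ℕn]*n x p)) (eq (+ residue x) (x /ℕ p) (+ p))))
    where
    eq : ∀ r q d → r - (r + q * d) ≡ - q * d
    eq = solve-∀

  +≈+⇒≡ : ∀ {x y} → x ℕ.< p → y ℕ.< p → + x ≈ + y → x ≡ y
  +≈+⇒≡ {x} {y} x<p y<p (mk≈ p∣x-y) with ℕ.∣ x - y ∣ in dist≡
  ... | zero  = ℕ.∣m-n∣≡0⇒m≡n dist≡
  ... | suc _ = contradiction (subst (p ℕ.∣_) dist≡ p∣dist) (ℕ.>⇒∤ (subst (ℕ._< p) dist≡ dist<p))
    where
    dist<p : ℕ.∣ x - y ∣ ℕ.< p
    dist<p = ℕ.≤-<-trans (ℕ.∣m-n∣≤m⊔n x y) (ℕ.⊔-lub x<p y<p)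
    p∣dist : p ℕ.∣ ℕ.∣ x - y ∣
    p∣dist = subst (p ℕ.∣_) (trans (cong ∣_∣ (m-n≡m⊖n x y)) (∣m⊖n∣≡∣m-n∣ x y)) (∣⇒∣ᵤ p∣x-y)

  residue≡⇒≈ : ∀ {x y} → residue x ≡ residue y → x ≈ y
  residue≡⇒≈ {x} {y} eq = ≈-trans (≈-sym (residue≈ x)) (≈-trans (≈-reflexive (cong +_ eq)) (residue≈ y))

  ≈⇒residue≡ : ∀ {x y} → x ≈ y → residue x ≡ residue y
  ≈⇒residue≡ {x} {y} x≈y =
    +≈+⇒≡ (residue<p x) (residue<p y) (≈-trans (residue≈ x) (≈-trans x≈y (≈-sym (residue≈ y))))

  _≈?_ : ∀ x y → Dec (x ≈ y)
  x ≈? y = Dec.map′ residue≡⇒≈ ≈⇒residue≡ (residue x ℕ.≟ residue y)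

  ∣⇒≈0 : ∀ {x} → + p ∣ x → x ≈ 0ℤ
  ∣⇒≈0 {x} p∣x = mk≈ (subst (+ p ∣_) (sym (+-identityʳ x)) p∣x)

  ≈0⇒∣ : ∀ {x} → x ≈ 0ℤ → + p ∣ x
  ≈0⇒∣ {x} (mk≈ p∣x-0) = subst (+ p ∣_) (+-identityʳ x) p∣x-0

  x-y≈0⇒x≈y : ∀ {x y} → x - y ≈ 0ℤ → x ≈ y
  x-y≈0⇒x≈y x-y≈0 = mk≈ (≈0⇒∣ x-y≈0)

  x≈y⇒x-y≈0 : ∀ {x y} → x ≈ y → x - y ≈ 0ℤ
  x≈y⇒x-y≈0 (mk≈ p∣x-y) = ∣⇒≈0 p∣x-y

  +[n*p]≈0 : ∀ n → + (n ℕ.* p) ≈ 0ℤ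
  +[n*p]≈0 n = ∣⇒≈0 (divides (+ n) (pos-* n p))

  quadratic-rescaling : ∀ {a b c d u w y} → b * c * w ≈ 1ℤ → y * y ≈ a * u * c * w →
    a + b * (y * y) ≈ a * (1ℤ + u) × c + d * (y * y) ≈ c * (1ℤ + u * (a * d * w))
  quadratic-rescaling {a} {b} {c} {d} {u} {w} {y} bcw≈1 y²≈aucw = a+by²≈a[1+u] , c+dy²≈c[1+ue]
    where
    open ≈-Reasoning
    a+by²≈a[1+u] : a + b * (y * y) ≈ a * (1ℤ + u)
    a+by²≈a[1+u] = begin
      a + b * (y * y)           ≈⟨ +-congˡ {a} (*-congˡ {b} y²≈aucw) ⟩
      a + b * (a * u * c * w)   ≡⟨ eq₁ a b c u w ⟩
      a + a * u * (b * c * w)   ≈⟨ +-congˡ {a} (*-congˡ {a * u} bcw≈1) ⟩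
      a + a * u * 1ℤ            ≡⟨ eq₂ a u ⟩
      a * (1ℤ + u)              ∎
      where
      eq₁ : ∀ a b c u w → a + b * (a * u * c * w) ≡ a + a * u * (b * c * w)
      eq₁ = solve-∀
      eq₂ : ∀ a u → a + a * u * 1ℤ ≡ a * (1ℤ + u)
      eq₂ = solve-∀
    c+dy²≈c[1+ue] : c + d * (y * y) ≈ c * (1ℤ + u * (a * d * w))
    c+dy²≈c[1+ue] = begin
      c + d * (y * y)           ≈⟨ +-congˡ {c} (*-congˡ {d} y²≈aucw) ⟩
      c + d * (a * u * c * w)   ≡⟨ eq a c d u w ⟩
      c * (1ℤ + u * (a * d * w)) ∎
      where
      eq : ∀ a c d u w → c + d * (a * u * c * w) ≡ c * (1ℤ + u * (a * d * w))
      eq = solve-∀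

module PrimeField {p : ℕ} (p-prime : Prime p) where

  private instance
    p-nonZero : NonZero p
    p-nonZero = prime⇒nonZero p-prime

  open Congruence p {{p-nonZero}} public

  x*y≈0⇒x≈0∨y≈0 : ∀ {x y} → x * y ≈ 0ℤ → x ≈ 0ℤ ⊎ y ≈ 0ℤ
  x*y≈0⇒x≈0∨y≈0 {x} {y} xy≈0 =
    Sum.map (∣⇒≈0 ∘ ∣ᵤ⇒∣) (∣⇒≈0 ∘ ∣ᵤ⇒∣)
      (euclidsLemma ∣ x ∣ ∣ y ∣ p-prime (subst (p ℕ.∣_) (abs-* x y) (∣⇒∣ᵤ (≈0⇒∣ xy≈0))))

  *-cancelʳ-≈ : ∀ {x y z} → z ≉ 0ℤ → x * z ≈ y * z → x ≈ y
  *-cancelʳ-≈ {x} {y} {z} z≉0 xz≈yz =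
    Sum.[ x-y≈0⇒x≈y , (λ z≈0 → contradiction z≈0 z≉0) ]′ (x*y≈0⇒x≈0∨y≈0 [x-y]z≈0)
    where
    [x-y]z≈0 : (x - y) * z ≈ 0ℤ
    [x-y]z≈0 = ≈-trans (≈-reflexive (eq x y z)) (x≈y⇒x-y≈0 xz≈yz)
      where
      eq : ∀ x y z → (x - y) * z ≡ x * z - y * z
      eq = solve-∀

  x²≈y²⇒x≈±y : ∀ {x y} → x * x ≈ y * y → x ≈ y ⊎ x ≈ - y
  x²≈y²⇒x≈±y {x} {y} x²≈y² =
    Sum.map x-y≈0⇒x≈y (x-y≈0⇒x≈y ∘ subst (_≈ 0ℤ) x+y≡x--y) (x*y≈0⇒x≈0∨y≈0 [x-y][x+y]≈0)
    where
    [x-y][x+y]≈0 : (x - y) * (x + y) ≈ 0ℤ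
    [x-y][x+y]≈0 = ≈-trans (≈-reflexive (eq x y)) (x≈y⇒x-y≈0 x²≈y²)
      where
      eq : ∀ x y → (x - y) * (x + y) ≡ x * x - y * y
      eq = solve-∀
    x+y≡x--y : x + y ≡ x - - y
    x+y≡x--y = cong (λ t → x + t) (sym (neg-involutive y))

  private
    bézoutCoefficient : ℕ → ℤ
    bézoutCoefficient r with Bézout.lemma r p
    ... | Bézout.result _ _ (Bézout.+- a _ _) = + a
    ... | Bézout.result _ _ (Bézout.-+ a _ _) = - + a

  -- The Bézout coefficient of the residue of x against p; a junk value when x ≈ 0.
  _⁻¹ : ℤ → ℤ
  x ⁻¹ = bézoutCoefficient (residue x)

  ⁻¹-cong : ∀ {x y} → x ≈ y → x ⁻¹ ≈ y ⁻¹
  ⁻¹-cong x≈y = ≈-reflexive (cong bézoutCoefficient (≈⇒residue≡ x≈y))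

  residue≢0 : ∀ {x} → x ≉ 0ℤ → residue x ≢ 0
  residue≢0 {x} x≉0 r≡0 = x≉0 (≈-trans (≈-sym (residue≈ x)) (≈-reflexive (cong +_ r≡0)))

  gcd[residue,p]≡1 : ∀ {x} → x ≉ 0ℤ → GCD (residue x) p 1
  gcd[residue,p]≡1 {x} x≉0 =
    coprime⇒GCD≡1 (Coprime.sym (prime⇒coprime p-prime {{ℕ.≢-nonZero (residue≢0 x≉0)}} (residue<p x)))

  *-inverseʳ : ∀ {x} → x ≉ 0ℤ → x * x ⁻¹ ≈ 1ℤ
  *-inverseʳ {x} x≉0 with Bézout.lemma (residue x) p
  ... | Bézout.result d gcd[r,p]≡d identity with GCD.unique gcd[r,p]≡d (gcd[residue,p]≡1 x≉0)
  ...   | refl with identity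
  ...     | Bézout.+- a b 1+bp≡ar = begin
    x * + a                  ≈⟨ *-congʳ (residue≈ x) ⟨
    + residue x * + a
      ≡⟨ trans (sym (pos-* (residue x) a)) (cong +_ (trans (ℕ.*-comm (residue x) a) (sym 1+bp≡ar))) ⟩
    1ℤ + + (b ℕ.* p)         ≈⟨ +-congˡ {1ℤ} (+[n*p]≈0 b) ⟩
    1ℤ + 0ℤ                  ∎
    where open ≈-Reasoning
  ...     | Bézout.-+ a b 1+ar≡bp = begin
    x * - + a                ≈⟨ *-congʳ (residue≈ x) ⟨
    + residue x * - + a      ≡⟨ eq (+ residue x) (+ a) ⟩
    1ℤ - (1ℤ + + residue x * + a)
      ≡⟨ cong (λ t → 1ℤ - (1ℤ + t)) (trans (sym (pos-* (residue x) a)) (cong +_ (ℕ.*-comm (residue x) a))) ⟩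
    1ℤ - + (1 ℕ.+ a ℕ.* residue x)  ≡⟨ cong (λ t → 1ℤ - + t) 1+ar≡bp ⟩
    1ℤ - + (b ℕ.* p)         ≈⟨ +-congˡ {1ℤ} (-‿cong (+[n*p]≈0 b)) ⟩
    1ℤ - 0ℤ                  ∎
    where
    open ≈-Reasoning
    eq : ∀ r a → r * - a ≡ 1ℤ - (1ℤ + r * a)
    eq = solve-∀

  1≉0 : 1ℤ ≉ 0ℤ
  1≉0 1≈0 = ℕ.1+n≢0 (+≈+⇒≡ (ℕ.nonTrivial⇒n>1 p {{prime⇒nonTrivial p-prime}}) 0<p 1≈0)

  *-≉0 : ∀ {x y} → x ≉ 0ℤ → y ≉ 0ℤ → x * y ≉ 0ℤ
  *-≉0 x≉0 y≉0 xy≈0 = Sum.[ x≉0 , y≉0 ]′ (x*y≈0⇒x≈0∨y≈0 xy≈0)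

  ⁻¹-≉0 : ∀ {x} → x ≉ 0ℤ → x ⁻¹ ≉ 0ℤ
  ⁻¹-≉0 {x} x≉0 x⁻¹≈0 = 1≉0 (begin
    1ℤ          ≈⟨ *-inverseʳ x≉0 ⟨
    x * x ⁻¹    ≈⟨ *-congˡ {x} x⁻¹≈0 ⟩
    x * 0ℤ      ≡⟨ *-zeroʳ x ⟩
    0ℤ          ∎)
    where open ≈-Reasoning

  ⁻¹-involutive : ∀ {x} → x ≉ 0ℤ → x ⁻¹ ⁻¹ ≈ x
  ⁻¹-involutive {x} x≉0 = *-cancelʳ-≈ (⁻¹-≉0 x≉0) (begin
    x ⁻¹ ⁻¹ * x ⁻¹   ≡⟨ *-comm (x ⁻¹ ⁻¹) (x ⁻¹) ⟩
    x ⁻¹ * x ⁻¹ ⁻¹   ≈⟨ *-inverseʳ (⁻¹-≉0 x≉0) ⟩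
    1ℤ               ≈⟨ *-inverseʳ x≉0 ⟨
    x * x ⁻¹         ∎)
    where open ≈-Reasoning

  x*y≈1⇒y≈x*y² : ∀ {x y} → x * y ≈ 1ℤ → y ≈ x * (y * y)
  x*y≈1⇒y≈x*y² {x} {y} xy≈1 = begin
    y               ≡⟨ *-identityˡ y ⟨
    1ℤ * y          ≈⟨ *-congʳ xy≈1 ⟨
    (x * y) * y     ≡⟨ *-assoc x y y ⟩
    x * (y * y)     ∎
    where open ≈-Reasoning

  root≉0 : ∀ {x z} → x ≉ 0ℤ → z * z ≈ x → z ≉ 0ℤ
  root≉0 {x} {z} x≉0 z²≈x z≈0 = x≉0 (begin
    x        ≈⟨ z²≈x ⟨
    z * z    ≈⟨ *-congʳ z≈0 ⟩
    0ℤ * z   ≡⟨ *-zeroˡ z ⟩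
    0ℤ       ∎)
    where open ≈-Reasoning

  ≉0-resp : (_≉ 0ℤ) Respects _≈_
  ≉0-resp x≈y x≉0 y≈0 = x≉0 (≈-trans x≈y y≈0)

  IsSquare : ℤ → Set
  IsSquare x = ∃ λ z → z * z ≈ x

  NonzeroSquare : ℤ → Set
  NonzeroSquare x = x ≉ 0ℤ × IsSquare x

  Nonsquare : ℤ → Set
  Nonsquare x = x ≉ 0ℤ × ¬ IsSquare x

  isSquare-z² : ∀ z → IsSquare (z * z)
  isSquare-z² z = z , ≈-refl

  isSquare-resp : IsSquare Respects _≈_
  isSquare-resp x≈y (z , z²≈x) = z , ≈-trans z²≈x x≈y

  nonzeroSquare-resp : NonzeroSquare Respects _≈_
  nonzeroSquare-resp x≈y (x≉0 , □x) = ≉0-resp x≈y x≉0 , isSquare-resp x≈y □x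

  nonsquare-resp : Nonsquare Respects _≈_
  nonsquare-resp x≈y (x≉0 , ¬□x) = ≉0-resp x≈y x≉0 , ¬□x ∘ isSquare-resp (≈-sym x≈y)

  isSquare? : Decidable IsSquare
  isSquare? x =
    Dec.map′ (λ (z , _ , z²≈x) → + z , z²≈x) reduceRoot (ℕ.anyUpTo? (λ z → + z * + z ≈? x) p)
    where
    reduceRoot : IsSquare x → ∃ λ z → z ℕ.< p × + z * + z ≈ x
    reduceRoot (z , z²≈x) = residue z , residue<p z , ≈-trans (*-cong (residue≈ z) (residue≈ z)) z²≈x

  nonzeroSquare? : Decidable NonzeroSquare
  nonzeroSquare? x = ¬? (x ≈? 0ℤ) ×-dec isSquare? x

  nonsquare? : Decidable Nonsquare
  nonsquare? x = ¬? (x ≈? 0ℤ) ×-dec ¬? (isSquare? x)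

  ¬nonsquare⇒nonzeroSquare : ∀ {x} → x ≉ 0ℤ → ¬ Nonsquare x → NonzeroSquare x
  ¬nonsquare⇒nonzeroSquare {x} x≉0 ¬■x = x≉0 , decidable-stable (isSquare? x) (¬■x ∘ (x≉0 ,_))

  isSquare-* : ∀ {x y} → IsSquare x → IsSquare y → IsSquare (x * y)
  isSquare-* (z , z²≈x) (w , w²≈y) = z * w , ≈-trans (≈-reflexive (eq z w)) (*-cong z²≈x w²≈y)
    where
    eq : ∀ z w → (z * w) * (z * w) ≡ (z * z) * (w * w)
    eq = solve-∀

  square*square : ∀ {x y} → NonzeroSquare x → NonzeroSquare y → NonzeroSquare (x * y)
  square*square (x≉0 , □x) (y≉0 , □y) = *-≉0 x≉0 y≉0 , isSquare-* □x □y

  square⁻¹ : ∀ {x} → NonzeroSquare x → NonzeroSquare (x ⁻¹)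
  square⁻¹ {x} (x≉0 , □x) =
    ⁻¹-≉0 x≉0 ,
    isSquare-resp (≈-sym (x*y≈1⇒y≈x*y² {x} (*-inverseʳ x≉0))) (isSquare-* □x (isSquare-z² (x ⁻¹)))

  nonsquare⁻¹ : ∀ {x} → Nonsquare x → Nonsquare (x ⁻¹)
  nonsquare⁻¹ {x} (x≉0 , ¬□x) = ⁻¹-≉0 x≉0 , λ □x⁻¹ →
    ¬□x (isSquare-resp (≈-sym (x*y≈1⇒y≈x*y² {x ⁻¹} x⁻¹x≈1)) (isSquare-* □x⁻¹ (isSquare-z² x)))
    where
    x⁻¹x≈1 : x ⁻¹ * x ≈ 1ℤ
    x⁻¹x≈1 = ≈-trans (≈-reflexive (*-comm (x ⁻¹) x)) (*-inverseʳ x≉0)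

  square*nonsquare : ∀ {x y} → NonzeroSquare x → Nonsquare y → Nonsquare (x * y)
  square*nonsquare {x} {y} ■x@(x≉0 , _) (y≉0 , ¬□y) = *-≉0 x≉0 y≉0 , λ □xy →
    ¬□y (isSquare-resp x⁻¹xy≈y (isSquare-* (proj₂ (square⁻¹ ■x)) □xy))
    where
    x⁻¹xy≈y : x ⁻¹ * (x * y) ≈ y
    x⁻¹xy≈y = begin
      x ⁻¹ * (x * y)   ≡⟨ eq (x ⁻¹) x y ⟩
      (x * x ⁻¹) * y   ≈⟨ *-congʳ (*-inverseʳ x≉0) ⟩
      1ℤ * y           ≡⟨ *-identityˡ y ⟩
      y                ∎
      where
      open ≈-Reasoning
      eq : ∀ u x y → u * (x * y) ≡ (x * u) * y
      eq = solve-∀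

  #_ : {P : Pred ℤ ℓ} → Decidable P → ℕ
  # P? = count (λ n → P? (+ n)) p

  #-cong : {P : Pred ℤ ℓ} {Q : Pred ℤ ℓ′} (P? : Decidable P) (Q? : Decidable Q) →
    (∀ {x} → P x ⇔ Q x) → # P? ≡ # Q?
  #-cong P? Q? P⇔Q = count-cong _ _ p (λ _ → P⇔Q)

  #-remove : {P : Pred ℤ ℓ} (P? : Decidable P) → P Respects _≈_ → ∀ {x} → P x →
    # P? ≡ suc (# (P? ∩? ∁? (_≈? x)))
  #-remove P? P-resp {x} Px = trans
    (count-remove (λ n → P? (+ n)) (residue<p x) (P-resp (≈-sym (residue≈ x)) Px))
    (cong suc (count-cong _ _ p λ n<p → mk⇔ (Prod.map₂ (_∘ ≈-to-≡ n<p)) (Prod.map₂ (_∘ ≡-to-≈ n<p))))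
    where
    ≈-to-≡ : ∀ {n} → n ℕ.< p → + n ≈ x → n ≡ residue x
    ≈-to-≡ n<p n≈x = trans (sym (residue-+ n<p)) (≈⇒residue≡ n≈x)
    ≡-to-≈ : ∀ {n} → n ℕ.< p → n ≡ residue x → + n ≈ x
    ≡-to-≈ n<p n≡rx = residue≡⇒≈ (trans (residue-+ n<p) n≡rx)

  #-injection : {P : Pred ℤ ℓ} {Q : Pred ℤ ℓ′} (P? : Decidable P) (Q? : Decidable Q) →
    Q Respects _≈_ →
    (f : ∀ {x} → P x → ℤ) → (∀ {x} (Px : P x) → Q (f Px)) →
    (∀ {x y} (Px : P x) (Py : P y) → f Px ≈ f Py → x ≈ y) →
    # P? ℕ.≤ # Q?
  #-injection {P = P} {Q = Q} P? Q? Q-resp f f-maps f-injective =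
    count-injection _ _ g λ {(m , m<p , Pm)} {(n , n<p , Pn)} eq →
      +≈+⇒≡ m<p n<p (f-injective Pm Pn (residue≡⇒≈ eq))
    where
    g : Below (λ n → P (+ n)) p → Below (λ n → Q (+ n)) p
    g (_ , _ , Pn) = residue (f Pn) , residue<p (f Pn) , Q-resp (≈-sym (residue≈ (f Pn))) (f-maps Pn)

  #-involution : {P : Pred ℤ ℓ} (P? : Decidable P) → P Respects _≈_ →
    (σ : ℤ → ℤ) → (∀ {x y} → x ≈ y → σ x ≈ σ y) →
    (∀ {x} → P x → P (σ x) × σ (σ x) ≈ x × σ x ≉ x) →
    ∃ λ k → # P? ≡ k ℕ.+ k
  #-involution {P = P} P? P-resp σ σ-cong σ-inv = count-involution _ σ′ p σ′-inv
    where
    σ′ : ℕ → ℕ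
    σ′ n = residue (σ (+ n))
    σ′≈ : ∀ n → + σ′ n ≈ σ (+ n)
    σ′≈ n = residue≈ (σ (+ n))
    σ′-inv : ∀ {n} → n ℕ.< p → P (+ n) → σ′ n ℕ.< p × P (+ σ′ n) × σ′ (σ′ n) ≡ n × σ′ n ≢ n
    σ′-inv {n} n<p Pn =
      let Pσn , σσn≈n , σn≉n = σ-inv Pn in
      residue<p (σ (+ n)) ,
      P-resp (≈-sym (σ′≈ n)) Pσn ,
      +≈+⇒≡ (residue<p (σ (+ σ′ n))) n<p
        (≈-trans (σ′≈ (σ′ n)) (≈-trans (σ-cong (σ′≈ n)) σσn≈n)) ,
      λ σ′n≡n → σn≉n (≈-trans (≈-sym (σ′≈ n)) (≈-reflexive (cong +_ σ′n≡n)))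

  0<#⇒∃ : {P : Pred ℤ ℓ} (P? : Decidable P) → 0 ℕ.< # P? → ∃ P
  0<#⇒∃ P? 0<# = let n , _ , Pn = 0<count⇒Below _ p 0<# in + n , Pn

  ≉0? : Decidable (_≉ 0ℤ)
  ≉0? x = ¬? (x ≈? 0ℤ)

  #≉0≡pred[p] : # ≉0? ≡ ℕ.pred p
  #≉0≡pred[p] =
    trans (count-cong _ (oneTo? (ℕ.pred p)) p nonzero⇔oneTo) (count-oneTo (ℕ.pred p) p pred[p]<p)
    where
    pred[p]<p : ℕ.pred p ℕ.< p
    pred[p]<p = ℕ.≤-reflexive (ℕ.suc-pred p)
    nonzero⇔oneTo : ∀ {n} → n ℕ.< p → + n ≉ 0ℤ ⇔ OneTo (ℕ.pred p) n
    nonzero⇔oneTo {n} n<p = mk⇔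
      (λ n≉0 → ℕ.n≢0⇒n>0 (λ n≡0 → n≉0 (≈-reflexive (cong +_ n≡0))) ,
               ℕ.≤-pred (subst (n ℕ.<_) (sym (ℕ.suc-pred p)) n<p))
      (λ (0<n , _) n≈0 → ℕ.<⇒≢ 0<n (sym (+≈+⇒≡ n<p 0<p n≈0)))

  #residue-oneTo : ∀ {h} → h ℕ.< p → # (λ x → oneTo? h (residue x)) ≡ h
  #residue-oneTo {h} h<p = trans (count-cong _ (oneTo? h) p residue-oneTo) (count-oneTo h p h<p)
    where
    residue-oneTo : ∀ {n} → n ℕ.< p → OneTo h (residue (+ n)) ⇔ OneTo h n
    residue-oneTo n<p = mk⇔ (subst (OneTo h) (residue-+ n<p)) (subst (OneTo h) (sym (residue-+ n<p)))

  nonzeroSquareMod⇒nonzeroSquare : ∀ {a} → NonzeroSquareMod p a → NonzeroSquare (+ a)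
  nonzeroSquareMod⇒nonzeroSquare {a} ((a<p , a≢0) , z , _ , z²%p≡a) =
    (λ a≈0 → a≢0 (+≈+⇒≡ a<p 0<p a≈0)) , + z , (begin
      + z * + z            ≡⟨ pos-* z z ⟨
      + (z ℕ.* z)          ≈⟨ residue≈ (+ (z ℕ.* z)) ⟨
      + ((z ℕ.* z) ℕ.% p)  ≡⟨ cong +_ z²%p≡a ⟩
      + a                  ∎)
    where open ≈-Reasoning

  private
    quadMod≈ : ∀ a b y → + quadMod p a b (residue y) ≈ + a + + b * (y * y)
    quadMod≈ a b y = begin
      + quadMod p a b y₀                   ≈⟨ residue≈ (+ (a ℕ.+ b ℕ.* (y₀ ℕ.* y₀))) ⟩
      + (a ℕ.+ b ℕ.* (y₀ ℕ.* y₀))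
        ≡⟨ trans (pos-+ a _) (cong (λ t → + a + t) (trans (pos-* b _) (cong (λ t → + b * t) (pos-* y₀ y₀)))) ⟩
      + a + + b * (+ y₀ * + y₀)
        ≈⟨ +-congˡ {+ a} (*-congˡ {+ b} (*-cong (residue≈ y) (residue≈ y))) ⟩
      + a + + b * (y * y)                  ∎
      where
      open ≈-Reasoning
      y₀ : ℕ
      y₀ = residue y

  nonsquare⇒nonsquareMod : ∀ a b y →
    Nonsquare (+ a + + b * (y * y)) → NonsquareMod p (quadMod p a b (residue y))
  nonsquare⇒nonsquareMod a b y ■v =
    (residue<p (+ (a ℕ.+ b ℕ.* (residue y ℕ.* residue y))) , λ v≡0 → v≉0 (≈-reflexive (cong +_ v≡0))) ,
    ¬□v ∘ proj₂ ∘ nonzeroSquareMod⇒nonzeroSquare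
    where
    v≉0 : + quadMod p a b (residue y) ≉ 0ℤ
    v≉0 = proj₁ (nonsquare-resp (≈-sym (quadMod≈ a b y)) ■v)
    ¬□v : ¬ IsSquare (+ quadMod p a b (residue y))
    ¬□v = proj₂ (nonsquare-resp (≈-sym (quadMod≈ a b y)) ■v)

  ≈0⇒quadMod≡0 : ∀ a b y → + a + + b * (y * y) ≈ 0ℤ → quadMod p a b (residue y) ≡ 0
  ≈0⇒quadMod≡0 a b y v≈0 = +≈+⇒≡ (residue<p (+ (a ℕ.+ b ℕ.* (residue y ℕ.* residue y)))) 0<p
    (≈-trans (quadMod≈ a b y) v≈0)

module OddPrime {p : ℕ} (p-prime : Prime p) {h : ℕ} (p≡1+h+h : p ≡ suc (h ℕ.+ h)) where

  open PrimeField p-prime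

  h<p : h ℕ.< p
  h<p = subst (h ℕ.<_) (sym p≡1+h+h) (ℕ.s≤s (ℕ.m≤m+n h h))

  Half : ℤ → Set
  Half x = OneTo h (residue x)

  half? : Decidable Half
  half? x = oneTo? h (residue x)

  half-resp : Half Respects _≈_
  half-resp x≈y = subst (OneTo h) (≈⇒residue≡ x≈y)

  half⇒≉0 : ∀ {x} → Half x → x ≉ 0ℤ
  half⇒≉0 {x} (0<rx , _) x≈0 = ℕ.<⇒≢ 0<rx (sym (trans (≈⇒residue≡ x≈0) (residue-+ 0<p)))

  fold : ℤ → ℤ
  fold z with residue z ℕ.≤? h
  ... | yes _ = z
  ... | no  _ = - z

  fold² : ∀ z → fold z * fold z ≈ z * z
  fold² z with residue z ℕ.≤? h
  ... | yes _ = ≈-refl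
  ... | no  _ = ≈-reflexive (eq z)
    where
    eq : ∀ z → - z * - z ≡ z * z
    eq = solve-∀

  fold-half : ∀ {z} → z ≉ 0ℤ → Half (fold z)
  fold-half {z} z≉0 with residue z ℕ.≤? h
  ... | yes rz≤h = ℕ.n≢0⇒n>0 (residue≢0 z≉0) , rz≤h
  ... | no  rz≰h = subst (OneTo h) (sym residue[-z]≡p∸rz) (ℕ.m<n⇒0<n∸m (residue<p z) , p∸rz≤h)
    where
    rz : ℕ
    rz = residue z
    h<rz : h ℕ.< rz
    h<rz = ℕ.≰⇒> rz≰h
    p∸rz≈-z : + (p ℕ.∸ rz) ≈ - z
    p∸rz≈-z = begin
      + (p ℕ.∸ rz)   ≡⟨ trans (m-n≡m⊖n p rz) (⊖-≥ (ℕ.<⇒≤ (residue<p z))) ⟨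
      + p - + rz     ≈⟨ +-cong p≈0 (-‿cong (residue≈ z)) ⟩
      0ℤ - z         ≡⟨ +-identityˡ (- z) ⟩
      - z            ∎
      where open ≈-Reasoning
    residue[-z]≡p∸rz : residue (- z) ≡ p ℕ.∸ rz
    residue[-z]≡p∸rz = trans (≈⇒residue≡ (≈-sym p∸rz≈-z))
      (residue-+ (ℕ.∸-monoʳ-< (ℕ.≤-<-trans ℕ.z≤n h<rz) (ℕ.<⇒≤ (residue<p z))))
    p∸rz≤h : p ℕ.∸ rz ℕ.≤ h
    p∸rz≤h = ℕ.≤-trans (ℕ.∸-monoʳ-≤ p h<rz)
      (ℕ.≤-reflexive (trans (cong (ℕ._∸ suc h) p≡1+h+h) (ℕ.m+n∸m≡n h h)))

  squaring-injective : ∀ {x y} → Half x → Half y → x * x ≈ y * y → x ≈ y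
  squaring-injective {x} {y} (0<rx , rx≤h) (_ , ry≤h) x²≈y² =
    Sum.[ id , (λ x≈-y → contradiction (rx+ry≡0 x≈-y) rx+ry≢0) ]′ (x²≈y²⇒x≈±y x²≈y²)
    where
    rx+ry≢0 : residue x ℕ.+ residue y ≢ 0
    rx+ry≢0 = ℕ.<⇒≢ (ℕ.<-≤-trans 0<rx (ℕ.m≤m+n (residue x) (residue y))) ∘ sym
    rx+ry<p : residue x ℕ.+ residue y ℕ.< p
    rx+ry<p = ℕ.≤-<-trans (ℕ.+-mono-≤ rx≤h ry≤h) (subst (h ℕ.+ h ℕ.<_) (sym p≡1+h+h) ℕ.≤-refl)
    rx+ry≡0 : x ≈ - y → residue x ℕ.+ residue y ≡ 0
    rx+ry≡0 x≈-y = +≈+⇒≡ rx+ry<p 0<p (begin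
      + (residue x ℕ.+ residue y)   ≡⟨ pos-+ (residue x) (residue y) ⟩
      + residue x + + residue y     ≈⟨ +-cong (residue≈ x) (residue≈ y) ⟩
      x + y                         ≈⟨ +-cong x≈-y ≈-refl ⟩
      - y + y                       ≡⟨ +-inverseˡ y ⟩
      0ℤ                            ∎)
      where open ≈-Reasoning

  #nonzeroSquare≡h : # nonzeroSquare? ≡ h
  #nonzeroSquare≡h = ℕ.≤-antisym
    (subst (# nonzeroSquare? ℕ.≤_) (#residue-oneTo h<p)
      (#-injection nonzeroSquare? half? half-resp (λ (_ , z , _) → fold z)
        (λ (x≉0 , z , z²≈x) → fold-half (root≉0 {z = z} x≉0 z²≈x)) folded-root-injective))
    (subst (ℕ._≤ # nonzeroSquare?) (#residue-oneTo h<p)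
      (#-injection half? nonzeroSquare? nonzeroSquare-resp (λ {x} _ → x * x)
        (λ {x} half-x → *-≉0 (half⇒≉0 {x} half-x) (half⇒≉0 {x} half-x) , isSquare-z² x)
        squaring-injective))
    where
    folded-root-injective : ∀ {x y} (■x : NonzeroSquare x) (■y : NonzeroSquare y) →
      fold (proj₁ (proj₂ ■x)) ≈ fold (proj₁ (proj₂ ■y)) → x ≈ y
    folded-root-injective {x} {y} (_ , z , z²≈x) (_ , w , w²≈y) fz≈fw = begin
      x                   ≈⟨ z²≈x ⟨
      z * z               ≈⟨ fold² z ⟨
      fold z * fold z     ≈⟨ *-cong fz≈fw fz≈fw ⟩
      fold w * fold w     ≈⟨ fold² w ⟩
      w * w               ≈⟨ w²≈y ⟩
      y                   ∎
      where open ≈-Reasoning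

  #nonsquare≡h : # nonsquare? ≡ h
  #nonsquare≡h = ℕ.+-cancelˡ-≡ h _ _ (begin
    h ℕ.+ # nonsquare?                  ≡⟨ cong (ℕ._+ # nonsquare?) #nonzeroSquare≡h ⟨
    # nonzeroSquare? ℕ.+ # nonsquare?   ≡⟨ count-partition _ _ p ⟨
    # ≉0?                               ≡⟨ #≉0≡pred[p] ⟩
    ℕ.pred p                            ≡⟨ cong ℕ.pred p≡1+h+h ⟩
    h ℕ.+ h                             ∎)
    where open ≡-Reasoning

  -- Otherwise s ↦ sy would map the h squares injectively to the h - 1 nonsquares other than xy.
  nonsquare*nonsquare : ∀ {x y} → Nonsquare x → Nonsquare y → NonzeroSquare (x * y)
  nonsquare*nonsquare {x} {y} ■x@(x≉0 , ¬□x) ■y@(y≉0 , _) =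
    ¬nonsquare⇒nonzeroSquare (*-≉0 x≉0 y≉0) λ ■xy → ℕ.<-irrefl refl (begin-strict
      # R?                 <⟨ ℕ.n<1+n (# R?) ⟩
      suc (# R?)           ≡⟨ #-remove nonsquare? nonsquare-resp ■xy ⟨
      # nonsquare?         ≡⟨ trans #nonsquare≡h (sym #nonzeroSquare≡h) ⟩
      # nonzeroSquare?     ≤⟨ #-injection nonzeroSquare? R? R-resp (λ {s} _ → s * y) into
                                (λ _ _ → *-cancelʳ-≈ y≉0) ⟩
      # R?                 ∎)
    where
    open ℕ.≤-Reasoning
    R? : Decidable (Nonsquare ∩ ∁ (_≈ x * y))
    R? = nonsquare? ∩? ∁? (_≈? x * y)
    R-resp : (λ s → Nonsquare s × s ≉ x * y) Respects _≈_
    R-resp s≈t (■s , s≉xy) = nonsquare-resp s≈t ■s , s≉xy ∘ ≈-trans s≈t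
    into : ∀ {s} → NonzeroSquare s → Nonsquare (s * y) × s * y ≉ x * y
    into ■s@(_ , □s) =
      square*nonsquare ■s ■y , λ sy≈xy → ¬□x (isSquare-resp (*-cancelʳ-≈ y≉0 sy≈xy) □s)

  private
    even≢odd : ∀ m n → m ℕ.+ m ≢ suc (n ℕ.+ n)
    even≢odd (suc m) zero    eq = ℕ.1+n≢0 (ℕ.suc-injective (trans (sym (ℕ.+-suc (suc m) m)) eq))
    even≢odd (suc m) (suc n) eq = even≢odd m n (ℕ.suc-injective (ℕ.suc-injective
      (trans (sym (ℕ.+-suc (suc m) m)) (trans eq (cong suc (ℕ.+-suc (suc n) n))))))

  module PrimeOneModFour {k : ℕ} (h≡k+k : h ≡ k ℕ.+ k) where

    -- Otherwise inversion would pair off the squares other than 1, making h - 1 even.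
    -1-nonzeroSquare : NonzeroSquare (- 1ℤ)
    -1-nonzeroSquare = ¬nonsquare⇒nonzeroSquare -1≉0 λ (_ , ¬□-1) →
      let j , #R≡j+j = #-involution R? R-resp _⁻¹ ⁻¹-cong (inversion ¬□-1) in
      even≢odd k j (let open ≡-Reasoning in begin
        k ℕ.+ k              ≡⟨ h≡k+k ⟨
        h                    ≡⟨ #nonzeroSquare≡h ⟨
        # nonzeroSquare?     ≡⟨ #-remove nonzeroSquare? nonzeroSquare-resp 1-nonzeroSquare ⟩
        suc (# R?)           ≡⟨ cong suc #R≡j+j ⟩
        suc (j ℕ.+ j)        ∎)
      where
      -1≉0 : - 1ℤ ≉ 0ℤ
      -1≉0 -1≈0 = 1≉0 (-‿cong -1≈0)
      1-nonzeroSquare : NonzeroSquare 1ℤ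
      1-nonzeroSquare = 1≉0 , isSquare-z² 1ℤ
      R? : Decidable (NonzeroSquare ∩ ∁ (_≈ 1ℤ))
      R? = nonzeroSquare? ∩? ∁? (_≈? 1ℤ)
      R-resp : (λ x → NonzeroSquare x × x ≉ 1ℤ) Respects _≈_
      R-resp x≈y (■x , x≉1) = nonzeroSquare-resp x≈y ■x , x≉1 ∘ ≈-trans x≈y
      inversion : ¬ IsSquare (- 1ℤ) → ∀ {x} → NonzeroSquare x × x ≉ 1ℤ →
        (NonzeroSquare (x ⁻¹) × x ⁻¹ ≉ 1ℤ) × x ⁻¹ ⁻¹ ≈ x × x ⁻¹ ≉ x
      inversion ¬□-1 {x} (■x@(x≉0 , □x) , x≉1) =
        (square⁻¹ ■x , x⁻¹≉1) , ⁻¹-involutive x≉0 , x⁻¹≉x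
        where
        x⁻¹≉1 : x ⁻¹ ≉ 1ℤ
        x⁻¹≉1 x⁻¹≈1 = x≉1 (begin
          x             ≡⟨ *-identityʳ x ⟨
          x * 1ℤ        ≈⟨ *-congˡ {x} x⁻¹≈1 ⟨
          x * x ⁻¹      ≈⟨ *-inverseʳ x≉0 ⟩
          1ℤ            ∎)
          where open ≈-Reasoning
        x⁻¹≉x : x ⁻¹ ≉ x
        x⁻¹≉x x⁻¹≈x = Sum.[ x≉1 , (λ x≈-1 → ¬□-1 (isSquare-resp x≈-1 □x)) ]′
          (x²≈y²⇒x≈±y (≈-trans (*-congˡ {x} (≈-sym x⁻¹≈x)) (*-inverseʳ x≉0)))

    private
      ∩-resp : {P Q : ℤ → Set} → P Respects _≈_ → Q Respects _≈_ → (λ x → P x × Q x) Respects _≈_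
      ∩-resp P-resp Q-resp x≈y = Prod.map (P-resp x≈y) (Q-resp x≈y)

      1+-resp : {P : ℤ → Set} → P Respects _≈_ → (λ x → P (1ℤ + x)) Respects _≈_
      1+-resp P-resp x≈y = P-resp (+-congˡ {1ℤ} x≈y)

      1+x≈0⇒x≈-1 : ∀ {x} → 1ℤ + x ≈ 0ℤ → x ≈ - 1ℤ
      1+x≈0⇒x≈-1 {x} 1+x≈0 = begin
        x                  ≡⟨ eq x ⟩
        (1ℤ + x) - 1ℤ      ≈⟨ +-cong 1+x≈0 ≈-refl ⟩
        0ℤ - 1ℤ            ∎
        where
        open ≈-Reasoning
        eq : ∀ x → x ≡ (1ℤ + x) - 1ℤ
        eq = solve-∀

    SN SS NS NN : ℤ → Set
    SN x = NonzeroSquare x × Nonsquare (1ℤ + x)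
    SS x = NonzeroSquare x × NonzeroSquare (1ℤ + x)
    NS x = Nonsquare x × NonzeroSquare (1ℤ + x)
    NN x = Nonsquare x × Nonsquare (1ℤ + x)

    sn? : Decidable SN
    sn? x = nonzeroSquare? x ×-dec nonsquare? (1ℤ + x)
    ss? : Decidable SS
    ss? x = nonzeroSquare? x ×-dec nonzeroSquare? (1ℤ + x)
    ns? : Decidable NS
    ns? x = nonsquare? x ×-dec nonzeroSquare? (1ℤ + x)
    nn? : Decidable NN
    nn? x = nonsquare? x ×-dec nonsquare? (1ℤ + x)

    h≡#SN+1+#SS : h ≡ # sn? ℕ.+ suc (# ss?)
    h≡#SN+1+#SS = begin
      h                                         ≡⟨ #nonzeroSquare≡h ⟨
      # nonzeroSquare?                          ≡⟨ count-partition _ _ p ⟩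
      # sn? ℕ.+ # R?
        ≡⟨ cong (# sn? ℕ.+_) (#-remove R? R-resp (-1-nonzeroSquare , -1∉R)) ⟩
      # sn? ℕ.+ suc (# (R? ∩? ∁? (_≈? - 1ℤ)))
        ≡⟨ cong (λ n → # sn? ℕ.+ suc n) (#-cong (R? ∩? ∁? (_≈? - 1ℤ)) ss? (mk⇔ to from)) ⟩
      # sn? ℕ.+ suc (# ss?)                     ∎
      where
      open ≡-Reasoning
      R? : Decidable (λ x → NonzeroSquare x × ¬ Nonsquare (1ℤ + x))
      R? = nonzeroSquare? ∩? ∁? (λ x → nonsquare? (1ℤ + x))
      R-resp : (λ x → NonzeroSquare x × ¬ Nonsquare (1ℤ + x)) Respects _≈_
      R-resp = ∩-resp nonzeroSquare-resp (λ x≈y ¬■[1+x] → ¬■[1+x] ∘ 1+-resp nonsquare-resp (≈-sym x≈y))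
      -1∉R : ¬ Nonsquare (1ℤ + - 1ℤ)
      -1∉R (0≉0 , _) = 0≉0 ≈-refl
      to : ∀ {x} → (NonzeroSquare x × ¬ Nonsquare (1ℤ + x)) × x ≉ - 1ℤ → SS x
      to ((■x , ¬■[1+x]) , x≉-1) = ■x , ¬nonsquare⇒nonzeroSquare (x≉-1 ∘ 1+x≈0⇒x≈-1) ¬■[1+x]
      from : ∀ {x} → SS x → (NonzeroSquare x × ¬ Nonsquare (1ℤ + x)) × x ≉ - 1ℤ
      from (■x , (1+x≉0 , □[1+x])) = (■x , λ (_ , ¬□[1+x]) → ¬□[1+x] □[1+x]) , 1+x≉0 ∘ +-congˡ {1ℤ}

    h≡#NS+#NN : h ≡ # ns? ℕ.+ # nn?
    h≡#NS+#NN = begin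
      h                                   ≡⟨ #nonsquare≡h ⟨
      # nonsquare?                        ≡⟨ count-partition _ _ p ⟩
      # ns? ℕ.+ # R?                      ≡⟨ cong (# ns? ℕ.+_) (#-cong R? nn? (mk⇔ to from)) ⟩
      # ns? ℕ.+ # nn?                     ∎
      where
      open ≡-Reasoning
      R? : Decidable (λ x → Nonsquare x × ¬ NonzeroSquare (1ℤ + x))
      R? = nonsquare? ∩? ∁? (λ x → nonzeroSquare? (1ℤ + x))
      to : ∀ {x} → Nonsquare x × ¬ NonzeroSquare (1ℤ + x) → NN x
      to {x} (■x@(_ , ¬□x) , ¬■[1+x]) = ■x , 1+x≉0 , ¬■[1+x] ∘ (1+x≉0 ,_)
        where
        1+x≉0 : 1ℤ + x ≉ 0ℤ
        1+x≉0 = ¬□x ∘ (λ x≈-1 → isSquare-resp (≈-sym x≈-1) (proj₂ -1-nonzeroSquare)) ∘ 1+x≈0⇒x≈-1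
      from : ∀ {x} → NN x → Nonsquare x × ¬ NonzeroSquare (1ℤ + x)
      from (■x , (_ , ¬□[1+x])) = ■x , ¬□[1+x] ∘ proj₂

    #NS≤#SN : # ns? ℕ.≤ # sn?
    #NS≤#SN = #-injection ns? sn? (∩-resp nonzeroSquare-resp (1+-resp nonsquare-resp))
      (λ {x} _ → - (1ℤ + x)) into (λ _ _ → injective)
      where
      into : ∀ {x} → NS x → SN (- (1ℤ + x))
      into {x} (■x , ■[1+x]) =
        nonzeroSquare-resp (≈-reflexive (eq₁ x)) (square*square -1-nonzeroSquare ■[1+x]) ,
        nonsquare-resp (≈-reflexive (eq₂ x)) (square*nonsquare -1-nonzeroSquare ■x)
        where
        eq₁ : ∀ x → - 1ℤ * (1ℤ + x) ≡ - (1ℤ + x)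
        eq₁ = solve-∀
        eq₂ : ∀ x → - 1ℤ * x ≡ 1ℤ + - (1ℤ + x)
        eq₂ = solve-∀
      injective : ∀ {x y} → - (1ℤ + x) ≈ - (1ℤ + y) → x ≈ y
      injective {x} {y} eq = begin
        x                      ≡⟨ eq₃ x ⟩
        - 1ℤ - - (1ℤ + x)      ≈⟨ +-congˡ { - 1ℤ} (-‿cong eq) ⟩
        - 1ℤ - - (1ℤ + y)      ≡⟨ eq₃ y ⟨
        y                      ∎
        where
        open ≈-Reasoning
        eq₃ : ∀ x → x ≡ - 1ℤ - - (1ℤ + x)
        eq₃ = solve-∀

    #NN≤#NS : # nn? ℕ.≤ # ns?
    #NN≤#NS = #-injection nn? ns? (∩-resp nonsquare-resp (1+-resp nonzeroSquare-resp))
      (λ {x} _ → x ⁻¹) into injective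
      where
      into : ∀ {x} → NN x → NS (x ⁻¹)
      into {x} (■x@(x≉0 , _) , ■[1+x]) =
        nonsquare⁻¹ ■x , nonzeroSquare-resp x⁻¹[1+x]≈1+x⁻¹ (nonsquare*nonsquare (nonsquare⁻¹ ■x) ■[1+x])
        where
        x⁻¹[1+x]≈1+x⁻¹ : x ⁻¹ * (1ℤ + x) ≈ 1ℤ + x ⁻¹
        x⁻¹[1+x]≈1+x⁻¹ = begin
          x ⁻¹ * (1ℤ + x)     ≡⟨ eq (x ⁻¹) x ⟩
          x * x ⁻¹ + x ⁻¹     ≈⟨ +-cong (*-inverseʳ x≉0) ≈-refl ⟩
          1ℤ + x ⁻¹           ∎
          where
          open ≈-Reasoning
          eq : ∀ u x → u * (1ℤ + x) ≡ x * u + u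
          eq = solve-∀
      injective : ∀ {x y} → NN x → NN y → x ⁻¹ ≈ y ⁻¹ → x ≈ y
      injective {x} {y} ((x≉0 , _) , _) ((y≉0 , _) , _) x⁻¹≈y⁻¹ = begin
        x            ≈⟨ ⁻¹-involutive x≉0 ⟨
        x ⁻¹ ⁻¹      ≈⟨ ⁻¹-cong x⁻¹≈y⁻¹ ⟩
        y ⁻¹ ⁻¹      ≈⟨ ⁻¹-involutive y≉0 ⟩
        y            ∎
        where open ≈-Reasoning

    #SS<#SN : # ss? ℕ.< # sn?
    #SS<#SN = ℕ.+-cancelˡ-≤ (# sn?) _ _ (begin
      # sn? ℕ.+ suc (# ss?)  ≡⟨ h≡#SN+1+#SS ⟨
      h                      ≡⟨ h≡#NS+#NN ⟩
      # ns? ℕ.+ # nn?        ≤⟨ ℕ.+-mono-≤ #NS≤#SN (ℕ.≤-trans #NN≤#NS #NS≤#SN) ⟩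
      # sn? ℕ.+ # sn?        ∎)
      where open ℕ.≤-Reasoning

    ∃SN-with-1+ue-nonsquare-or-0 : ∀ {e} → NonzeroSquare e →
      ∃ λ u → SN u × (Nonsquare (1ℤ + u * e) ⊎ 1ℤ + u * e ≈ 0ℤ)
    ∃SN-with-1+ue-nonsquare-or-0 {e} ■e@(e≉0 , _) = 0<#⇒∃ G? (ℕ.n≢0⇒n>0 λ #G≡0 →
      ℕ.<⇒≱ #SS<#SN (begin
        # sn?              ≡⟨ count-partition _ _ p ⟩
        # G? ℕ.+ # B?      ≡⟨ cong (ℕ._+ # B?) #G≡0 ⟩
        # B?               ≤⟨ #-injection B? ss? (∩-resp nonzeroSquare-resp (1+-resp nonzeroSquare-resp))
                                (λ {u} _ → u * e) into (λ _ _ → *-cancelʳ-≈ e≉0) ⟩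
        # ss?              ∎))
      where
      open ℕ.≤-Reasoning
      Good : ℤ → Set
      Good u = Nonsquare (1ℤ + u * e) ⊎ 1ℤ + u * e ≈ 0ℤ
      good? : Decidable Good
      good? u = nonsquare? (1ℤ + u * e) ⊎-dec 1ℤ + u * e ≈? 0ℤ
      G? : Decidable (SN ∩ Good)
      G? = sn? ∩? good?
      B? : Decidable (SN ∩ ∁ Good)
      B? = sn? ∩? ∁? good?
      into : ∀ {u} → SN u × ¬ Good u → SS (u * e)
      into ((■u , _) , ¬good) =
        square*square ■u ■e , ¬nonsquare⇒nonzeroSquare (¬good ∘ inj₂) (¬good ∘ inj₁)

    nonsquare-values : ∀ {a b c d} →
      NonzeroSquare a → NonzeroSquare b → NonzeroSquare c → NonzeroSquare d →
      ∃ λ y → y ≉ 0ℤ × Nonsquare (a + b * (y * y)) × (Nonsquare (c + d * (y * y)) ⊎ c + d * (y * y) ≈ 0ℤ)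
    nonsquare-values {a} {b} {c} {d} ■a ■b@(b≉0 , _) ■c@(c≉0 , _) ■d =
      let w = (b * c) ⁻¹
          ■w = square⁻¹ (square*square ■b ■c)
          u , (■u , ■[1+u]) , 1+ue■⊎0 = ∃SN-with-1+ue-nonsquare-or-0 (square*square (square*square ■a ■d) ■w)
          t≉0 , y , y²≈t = square*square (square*square (square*square ■a ■u) ■c) ■w
          ab≈ , cd≈ = quadratic-rescaling {a} {b} {c} {d} {u} {w} {y} (*-inverseʳ (*-≉0 b≉0 c≉0)) y²≈t
      in
      y , root≉0 {z = y} t≉0 y²≈t ,
      nonsquare-resp (≈-sym ab≈) (square*nonsquare ■a ■[1+u]) ,
      Sum.map (nonsquare-resp (≈-sym cd≈) ∘ square*nonsquare ■c)
              (λ 1+ue≈0 → ≈-trans cd≈ (≈-trans (*-congˡ {c} 1+ue≈0) (≈-reflexive (*-zeroʳ c))))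
              1+ue■⊎0

p≡1+4[p/4] : ∀ p .{{_ : NonZero p}} → p % 4 ≡ 1 →
  let q = p ℕ./ 4 in p ≡ ℕ.suc ((q ℕ.+ q) ℕ.+ (q ℕ.+ q))
p≡1+4[p/4] p p%4≡1 = begin
  p                        ≡⟨ ℕ.m≡m%n+[m/n]*n p 4 ⟩
  p % 4 ℕ.+ q ℕ.* 4        ≡⟨ cong (ℕ._+ q ℕ.* 4) p%4≡1 ⟩
  ℕ.suc (q ℕ.* 4)          ≡⟨ cong ℕ.suc (eq q) ⟩
  ℕ.suc ((q ℕ.+ q) ℕ.+ (q ℕ.+ q)) ∎
  where
  open ≡-Reasoning
  q : ℕ
  q = p ℕ./ 4
  eq : ∀ q → q ℕ.* 4 ≡ (q ℕ.+ q) ℕ.+ (q ℕ.+ q)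
  eq = ℕ-Solver.solve-∀

lemma5p5 : (p : ℕ) .{{_ : NonZero p}} → Prime p → p % 4 ≡ 1 →
    (a b c d : ℕ) →
    NonzeroSquareMod p a → NonzeroSquareMod p b →
    NonzeroSquareMod p c → NonzeroSquareMod p d →
    Σ ℕ (λ y₀ → NonzeroMod p y₀ ×
    ((NonsquareMod p (quadMod p a b y₀) × NonsquareMod p (quadMod p c d y₀))
    ⊎ (NonsquareMod p (quadMod p a b y₀) × quadMod p c d y₀ ≡ 0)))
lemma5p5 p p-prime p%4≡1 a b c d ■a ■b ■c ■d =
  let y , y≉0 , ■ab , ■cd⊎0 = nonsquare-values (toℤ ■a) (toℤ ■b) (toℤ ■c) (toℤ ■d) in
  residue y , (residue<p y , residue≢0 y≉0) ,
  Sum.map (λ ■cd → nonsquare⇒nonsquareMod a b y ■ab , nonsquare⇒nonsquareMod c d y ■cd)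
          (λ cd≈0 → nonsquare⇒nonsquareMod a b y ■ab , ≈0⇒quadMod≡0 c d y cd≈0)
          ■cd⊎0
  where
  open PrimeField p-prime
  q = p ℕ./ 4
  open OddPrime p-prime {q ℕ.+ q} (p≡1+4[p/4] p p%4≡1)
  open PrimeOneModFour {q} refl
  toℤ = nonzeroSquareMod⇒nonzeroSquare
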